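{- Let $P=(X,\leq)$ be a finite interval order and let $\lambda_1,\lambda_2$ be two admissible labellings of $P$. Then there exists an automorphism $f$ of $P$ such that $\lambda_1(x)=\lambda_2(f(x))$ for all $x\in X$.
   Context: A finite poset $P=(X,\leq)$ is an interval order if there is a map assigning to each $x\in X$ a closed real interval $[a_x,b_x]$ such that $x<y$ in $P$ iff $b_x<a_y$ (equivalently, $P$ has no induced subposet isomorphic to $2+2$). For $x\in X$ let $I(x)=\{z: z<x\}$ and $F(x)=\{z : z>x\}$ (strict). Write $x\sim y$ if $I(x)=I(y)$ and $F(x)=F(y)$. A linear extension of $P$ is a bijection $\lambda:X\to\{1,\dots,|X|\}$ with $x<y\Rightarrow\lambda(x)<\lambda(y)$. A linear extension $\lambda$ is an admissible labelling if for all $x,y\in X$ with $\lambda(x)<\lambda(y)$, either $I(x)\subset I(y)$, or ($I(x)=I(y)$ and $F(x)\subset F(y)$), or $x\sim y$. -}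

module Defs where

open import Data.Nat using (ℕ)
open import Data.Fin using (Fin) renaming (_<_ to _<ᶠ_)
open import Data.Rational using (ℚ) renaming (_≤_ to _≤ℚ_; _<_ to _<ℚ_)
open import Data.Product using (_×_; Σ)
open import Data.Sum using (_⊎_)
open import Relation.Nullary using (¬_)
open import Relation.Binary.PropositionalEquality using (_≡_; _≢_)
open import Function.Definitions using (Bijective)
open import Level using (0ℓ)

record IsPoset (n : ℕ) (_≤_ : Fin n → Fin n → Set) : Set where
  field
    refl    : ∀ x → x ≤ x
    antisym : ∀ x y → x ≤ y → y ≤ x → x ≡ y
    trans   : ∀ x y z → x ≤ y → y ≤ z → x ≤ z

module _ {n : ℕ} (_≤_ : Fin n → Fin n → Set) where

  _<_ : Fin n → Fin n → Set
  x < y = (x ≤ y) × (x ≢ y)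

  -- interval order: closed intervals [a x , b x] with x < y iff b x < a y
  -- (intervals with rational endpoints; for finite posets equivalent to real ones)
  IsIntervalOrder : Set
  IsIntervalOrder =
    Σ (Fin n → ℚ) λ a → Σ (Fin n → ℚ) λ b →
      (∀ x → a x ≤ℚ b x) × (∀ x y → (x < y → b x <ℚ a y) × (b x <ℚ a y → x < y))

  I⊆ : Fin n → Fin n → Set
  I⊆ x y = ∀ z → z < x → z < y

  I≡ : Fin n → Fin n → Set
  I≡ x y = I⊆ x y × I⊆ y x

  I⊂ : Fin n → Fin n → Set
  I⊂ x y = I⊆ x y × ¬ I⊆ y x

  F⊆ : Fin n → Fin n → Set
  F⊆ x y = ∀ z → x < z → y < z

  F≡ : Fin n → Fin n → Set
  F≡ x y = F⊆ x y × F⊆ y x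

  F⊂ : Fin n → Fin n → Set
  F⊂ x y = F⊆ x y × ¬ F⊆ y x

  _∼_ : Fin n → Fin n → Set
  x ∼ y = I≡ x y × F≡ x y

  -- linear extension: bijection onto {1..n} (here Fin n, i.e. {0..n-1})
  IsLinearExtension : (Fin n → Fin n) → Set
  IsLinearExtension λ' =
    Bijective _≡_ _≡_ λ' × (∀ x y → x < y → λ' x <ᶠ λ' y)

  IsAdmissibleLabelling : (Fin n → Fin n) → Set
  IsAdmissibleLabelling λ' =
    IsLinearExtension λ' ×
    (∀ x y → λ' x <ᶠ λ' y →
       I⊂ x y ⊎ (I≡ x y × F⊂ x y) ⊎ (x ∼ y))

  IsAutomorphism : (Fin n → Fin n) → Set
  IsAutomorphism f =
    Bijective _≡_ _≡_ f × (∀ x y → (x ≤ y → f x ≤ f y) × (f x ≤ f y → x ≤ y))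

{-# OPTIONS --safe #-}
module Submission where

-- An admissible labelling is monotone for the preorder
-- x ≼ y :⇔ I(x) ⊆ I(y) and (I(x) = I(y) ⇒ F(x) ⊆ F(y)), whose symmetric part is ∼.
-- If two bijections Fin n → Fin n are monotone for ≼ and λ₁ a = λ₂ b = k, then
-- counting gives some z with λ₁ z ≤ k ≤ λ₂ z, whence b ≼ z ≼ a, and symmetrically
-- a ≼ b. So f = λ₂⁻¹ ∘ λ₁ moves every element within its ∼-class, and ∼-equivalent
-- elements have the same strict predecessors and successors, so f is an
-- automorphism.

open import Defs
open import Data.Nat using (ℕ)
open import Data.Fin using (Fin)
open import Data.Product using (_×_; Σ)
open import Relation.Binary.PropositionalEquality using (_≡_)

import Data.Nat as ℕ
import Data.Nat.Properties as ℕ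
open import Data.Fin as Fin using (toℕ; fromℕ<; inject≤)
open import Data.Fin.Properties
  using (any?; _≤?_; toℕ<n; toℕ-fromℕ<; toℕ-inject≤; toℕ-injective; inject≤-injective;
         <⇒notInjective; _≟_)
open import Data.Product using (proj₁; proj₂; _,_; ∃)
open import Data.Sum using (inj₁; inj₂)
open import Data.Empty using (⊥-elim)
open import Relation.Nullary using (yes; no; contradiction)
open import Relation.Nullary.Decidable using (_×-dec_)
open import Relation.Binary.PropositionalEquality using (refl; sym; trans; cong; subst)
open import Function.Definitions using (Injective; Surjective; Bijective)

crossing : {n : ℕ} (l₁ l₂ : Fin n → Fin n) →
           Surjective _≡_ _≡_ l₁ → Injective _≡_ _≡_ l₂ →
           (k : Fin n) → ∃ λ z → l₁ z Fin.≤ k × k Fin.≤ l₂ z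
crossing l₁ l₂ l₁-surjective l₂-injective k
  with any? (λ z → (l₁ z ≤? k) ×-dec (k ≤? l₂ z))
... | yes found = found
-- Otherwise l₂ ∘ l₁⁻¹ would inject the k + 1 labels ≤ k into the k labels < k.
... | no none = ⊥-elim (<⇒notInjective (ℕ.n<1+n (toℕ k)) squeeze-injective)
  where
    embed : Fin (ℕ.suc (toℕ k)) → Fin _
    embed i = inject≤ i (toℕ<n k)

    source : Fin (ℕ.suc (toℕ k)) → Fin _
    source i = proj₁ (l₁-surjective (embed i))

    l₁∘source : ∀ i → l₁ (source i) ≡ embed i
    l₁∘source i = proj₂ (l₁-surjective (embed i)) refl

    l₂∘source< : ∀ i → toℕ (l₂ (source i)) ℕ.< toℕ k
    l₂∘source< i = ℕ.≰⇒> λ k≤ → none (source i , below , k≤)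
      where
        below : l₁ (source i) Fin.≤ k
        below rewrite l₁∘source i | toℕ-inject≤ i (toℕ<n k) = ℕ.s≤s⁻¹ (toℕ<n i)

    squeeze : Fin (ℕ.suc (toℕ k)) → Fin (toℕ k)
    squeeze i = fromℕ< (l₂∘source< i)

    squeeze-injective : Injective _≡_ _≡_ squeeze
    squeeze-injective {i} {j} eq = inject≤-injective _ _ i j embed-eq
      where
        source-eq : source i ≡ source j
        source-eq = l₂-injective (toℕ-injective
          (trans (sym (toℕ-fromℕ< (l₂∘source< i)))
                 (trans (cong toℕ eq) (toℕ-fromℕ< (l₂∘source< j)))))

        embed-eq : embed i ≡ embed j
        embed-eq = trans (sym (l₁∘source i)) (trans (cong l₁ source-eq) (l₁∘source j))

relabelling : {A B : Set} (l₁ l₂ : A → B) →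
              Bijective _≡_ _≡_ l₁ → Bijective _≡_ _≡_ l₂ →
              Σ (A → A) λ f → Bijective _≡_ _≡_ f × (∀ x → l₁ x ≡ l₂ (f x))
relabelling l₁ l₂ (l₁-injective , l₁-surjective) (l₂-injective , l₂-surjective) =
  f , (f-injective , f-surjective) , l₁≡l₂∘f
  where
    f : _ → _
    f x = proj₁ (l₂-surjective (l₁ x))

    l₁≡l₂∘f : ∀ x → l₁ x ≡ l₂ (f x)
    l₁≡l₂∘f x = sym (proj₂ (l₂-surjective (l₁ x)) refl)

    f-injective : Injective _≡_ _≡_ f
    f-injective {x} {y} eq =
      l₁-injective (trans (l₁≡l₂∘f x) (trans (cong l₂ eq) (sym (l₁≡l₂∘f y))))

    f-surjective : Surjective _≡_ _≡_ f
    f-surjective y = x , λ {z} z≡x →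
      l₂-injective (trans (sym (l₁≡l₂∘f z)) (trans (cong l₁ z≡x) l₁x≡l₂y))
      where
        x = proj₁ (l₁-surjective (l₂ y))
        l₁x≡l₂y = proj₂ (l₁-surjective (l₂ y)) refl

module _ {n : ℕ} (_≤_ : Fin n → Fin n → Set) where

  private
    _≺_ : Fin n → Fin n → Set
    _≺_ = _<_ _≤_

    _≃_ : Fin n → Fin n → Set
    _≃_ = _∼_ _≤_

  _≼_ : Fin n → Fin n → Set
  x ≼ y = I⊆ _≤_ x y × (I⊆ _≤_ y x → F⊆ _≤_ x y)

  ≼-refl : ∀ {x} → x ≼ x
  ≼-refl = (λ _ z<x → z<x) , (λ _ _ x<z → x<z)

  ≼-trans : ∀ {x y z} → x ≼ y → y ≼ z → x ≼ z
  ≼-trans (Ix⊆Iy , Fx⊆Fy) (Iy⊆Iz , Fy⊆Fz) =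
    (λ w w<x → Iy⊆Iz w (Ix⊆Iy w w<x)) ,
    λ Iz⊆Ix → λ w x<w →
      Fy⊆Fz (λ v v<z → Ix⊆Iy v (Iz⊆Ix v v<z))
            w (Fx⊆Fy (λ v v<y → Iz⊆Ix v (Iy⊆Iz v v<y)) w x<w)

  ≼-antisym : ∀ {x y} → x ≼ y → y ≼ x → x ≃ y
  ≼-antisym (Ix⊆Iy , Fx⊆Fy) (Iy⊆Ix , Fy⊆Fx) = (Ix⊆Iy , Iy⊆Ix) , (Fx⊆Fy Iy⊆Ix , Fy⊆Fx Ix⊆Iy)

  ∼-sym : ∀ {x y} → x ≃ y → y ≃ x
  ∼-sym ((Ix⊆Iy , Iy⊆Ix) , (Fx⊆Fy , Fy⊆Fx)) = (Iy⊆Ix , Ix⊆Iy) , (Fy⊆Fx , Fx⊆Fy)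

  ∼-resp-≺ : ∀ {x y x′ y′} → x ≃ x′ → y ≃ y′ → x ≺ y → x′ ≺ y′
  ∼-resp-≺ {x′ = x′} (_ , (Fx⊆Fx′ , _)) ((Iy⊆Iy′ , _) , _) x≺y = Iy⊆Iy′ x′ (Fx⊆Fx′ _ x≺y)

  admissible-monotone : ∀ {l} → IsAdmissibleLabelling _≤_ l →
                        ∀ {x y} → l x Fin.≤ l y → x ≼ y
  admissible-monotone {l} (((l-injective , _) , _) , admissible) {x} {y} lx≤ly
    with ℕ.m≤n⇒m<n∨m≡n lx≤ly
  ... | inj₂ lx≡ly = subst (x ≼_) (l-injective (toℕ-injective lx≡ly)) ≼-refl
  ... | inj₁ lx<ly with admissible x y lx<ly
  ...   | inj₁ (Ix⊆Iy , Iy⊈Ix)                 = Ix⊆Iy , λ Iy⊆Ix → contradiction Iy⊆Ix Iy⊈Ix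
  ...   | inj₂ (inj₁ ((Ix⊆Iy , _) , (Fx⊆Fy , _))) = Ix⊆Iy , λ _ → Fx⊆Fy
  ...   | inj₂ (inj₂ ((Ix⊆Iy , _) , (Fx⊆Fy , _))) = Ix⊆Iy , λ _ → Fx⊆Fy

  ≼-of-equal-labels : ∀ {l₁ l₂} → IsAdmissibleLabelling _≤_ l₁ → IsAdmissibleLabelling _≤_ l₂ →
                      ∀ {a b} → l₁ a ≡ l₂ b → b ≼ a
  ≼-of-equal-labels {l₁} {l₂} adm₁@(((_ , l₁-surjective) , _) , _) adm₂@(((l₂-injective , _) , _) , _)
                    {a} {b} l₁a≡l₂b
    with crossing l₁ l₂ l₁-surjective l₂-injective (l₂ b)
  ... | z , l₁z≤l₂b , l₂b≤l₂z =
    ≼-trans (admissible-monotone adm₂ l₂b≤l₂z)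
            (admissible-monotone adm₁ (subst (l₁ z Fin.≤_) (sym l₁a≡l₂b) l₁z≤l₂b))

  equal-labels⇒∼ : ∀ {l₁ l₂} → IsAdmissibleLabelling _≤_ l₁ → IsAdmissibleLabelling _≤_ l₂ →
                   ∀ {a b} → l₁ a ≡ l₂ b → a ≃ b
  equal-labels⇒∼ adm₁ adm₂ l₁a≡l₂b =
    ≼-antisym (≼-of-equal-labels adm₂ adm₁ (sym l₁a≡l₂b)) (≼-of-equal-labels adm₁ adm₂ l₁a≡l₂b)

  ∼-preserving⇒automorphism : IsPoset n _≤_ → ∀ {f} → Bijective _≡_ _≡_ f →
                              (∀ x → x ≃ f x) → IsAutomorphism _≤_ f
  ∼-preserving⇒automorphism poset {f} f-bijective@(f-injective , _) x∼fx =
    f-bijective , λ x y → preserve x y , reflect x y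
    where
      open IsPoset poset using () renaming (refl to ≤-refl)

      preserve : ∀ x y → x ≤ y → f x ≤ f y
      preserve x y x≤y with x ≟ y
      ... | yes refl = ≤-refl (f x)
      ... | no  x≢y  = proj₁ (∼-resp-≺ (x∼fx x) (x∼fx y) (x≤y , x≢y))

      reflect : ∀ x y → f x ≤ f y → x ≤ y
      reflect x y fx≤fy with x ≟ y
      ... | yes refl = ≤-refl x
      ... | no  x≢y  = proj₁ (∼-resp-≺ (∼-sym (x∼fx x)) (∼-sym (x∼fx y))
                                       (fx≤fy , λ fx≡fy → x≢y (f-injective fx≡fy)))

mainTheorem5 : (n : ℕ) (_≤_ : Fin n → Fin n → Set) → IsPoset n _≤_ → IsIntervalOrder _≤_ →
    (λ₁ λ₂ : Fin n → Fin n) → IsAdmissibleLabelling _≤_ λ₁ → IsAdmissibleLabelling _≤_ λ₂ →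
    Σ (Fin n → Fin n) λ f → IsAutomorphism _≤_ f × (∀ x → λ₁ x ≡ λ₂ (f x))
mainTheorem5 n _≤_ poset _ λ₁ λ₂ adm₁@((λ₁-linext , _) , _) adm₂@((λ₂-linext , _) , _)
  with relabelling λ₁ λ₂ λ₁-linext λ₂-linext
... | f , f-bijective , λ₁≡λ₂∘f =
  f , ∼-preserving⇒automorphism _≤_ poset f-bijective
        (λ x → equal-labels⇒∼ _≤_ adm₁ adm₂ (λ₁≡λ₂∘f x)) , λ₁≡λ₂∘f
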